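{- Let $r,s$ be positive integers and $G=\mathbb{Z}_2^r\times\mathbb{Z}_4^s$. Let $\alpha=(\alpha_1,\ldots,\alpha_r,\alpha_{r+1},\ldots,\alpha_{r+s})\in G$ (with $\alpha_1,\ldots,\alpha_r\in\mathbb{Z}_2$, $\alpha_{r+1},\ldots,\alpha_{r+s}\in\mathbb{Z}_4$) be a vertex of the power graph $\mathcal{G}(G)$ with $|\alpha|=2$. (i) If $\alpha_i\neq 0$ for some $1\le i\le r$, then $\deg(\alpha)=1$. (ii) If $\alpha_i=0$ for all $1\le i\le r$, then $\deg(\alpha)=2^{r+s}+1$.
   Context: For a finite group $G$, the power graph $\mathcal{G}(G)$ is the simple graph with vertex set $G$ in which two distinct vertices are adjacent if and only if one is a power of the other. $\mathbb{Z}_k^t$ denotes the direct product of $t$ copies of the cyclic group $\mathbb{Z}_k=\{0,1,\ldots,k-1\}$; $|\alpha|$ is the order of $\alpha$ and $\deg(\alpha)$ its degree in $\mathcal{G}(G)$. -}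

module Defs where

open import Data.Nat using (ℕ; zero; suc; _+_; _<_; NonZero)
open import Data.Nat.DivMod using (_%_; m%n<n)
open import Data.Fin using (Fin; toℕ; fromℕ<)
import Data.Fin as Fin
open import Data.Vec using (Vec; zipWith; replicate)
open import Data.Product using (Σ; ∃; _×_; _,_)
open import Data.Sum using (_⊎_)
open import Data.List using (List; length)
open import Data.List.Membership.Propositional using (_∈_)
open import Data.List.Relation.Unary.Unique.Propositional using (Unique)
open import Relation.Binary.PropositionalEquality using (_≡_; _≢_)
open import Function.Bundles using (_⇔_)

_+ₘ_ : {k : ℕ} .{{_ : NonZero k}} → Fin k → Fin k → Fin k
_+ₘ_ {k} a b = fromℕ< (m%n<n (toℕ a + toℕ b) k)

Zpow : ℕ → ℕ → Set
Zpow k t = Vec (Fin k) t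

G : ℕ → ℕ → Set
G r s = Zpow 2 r × Zpow 4 s

_⊕_ : {r s : ℕ} → G r s → G r s → G r s
(a , b) ⊕ (c , d) = zipWith _+ₘ_ a c , zipWith _+ₘ_ b d

0G : {r s : ℕ} → G r s
0G = replicate _ Fin.zero , replicate _ Fin.zero

-- k-th "power" of α (in additive notation: k·α).
_·_ : {r s : ℕ} → ℕ → G r s → G r s
zero · α = 0G
suc k · α = α ⊕ (k · α)

IsPowerOf : {r s : ℕ} → G r s → G r s → Set
IsPowerOf β α = ∃ λ (k : ℕ) → k · α ≡ β

Adjacent : {r s : ℕ} → G r s → G r s → Set
Adjacent α β = α ≢ β × (IsPowerOf β α ⊎ IsPowerOf α β)

HasOrder : {r s : ℕ} → G r s → ℕ → Set
HasOrder α n = (0 < n) × (n · α ≡ 0G) × (∀ m → 0 < m → m < n → m · α ≢ 0G)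

HasCardinality : {A : Set} → (A → Set) → ℕ → Set
HasCardinality {A} P n =
  Σ (List A) λ xs → Unique xs × (∀ x → (x ∈ xs) ⇔ P x) × (length xs ≡ n)

HasDegree : {r s : ℕ} → G r s → ℕ → Set
HasDegree α d = HasCardinality (Adjacent α) d

module Submission where

-- Multiplication by k acts coordinatewise on G, as k ⊙ x in each
-- factor ℤ_(m+1); modular arithmetic gives the scalar laws (identity,
-- distributivity, associativity, annihilation by multiples of m+1), which
-- lift to G.  Hence 4 · β = 0 for every β, so the multiples of β are
-- 0, β, 2β, 3β, and 3 · (3 · β) = β.  For α of order 2 this classifies the
-- power-graph neighbours of α: they are 0 together with the halves of α
-- (the β with 2 · β = α), and 0 is not a half, so deg α = 1 + #halves.
-- Counting halves coordinatewise: if some ℤ₂-coordinate of α is nonzero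
-- there are none (2 · x = 0 in ℤ₂), giving (i); otherwise every coordinate
-- has exactly two halves, giving 2^(r+s) halves and (ii).

open import Defs
open import Data.Nat using (ℕ; zero; suc; _+_; _*_; _^_; _%_; _≤_; NonZero; s≤s; z≤n)
open import Data.Nat.Properties using (*-identityˡ; *-distribʳ-+; *-assoc; +-comm; ^-distribˡ-+-*)
open import Data.Nat.DivMod using (%-distribˡ-+; %-distribˡ-*; m%n%n≡m%n; m<n⇒m%n≡m)
open import Data.Nat.Divisibility using (_∣_; divides; n∣m⇒m%n≡0)
open import Data.Fin using (Fin; zero; suc; toℕ)
open import Data.Fin.Properties using (toℕ-injective; toℕ-fromℕ<; toℕ<n; _≟_)
open import Data.Vec using (Vec; []; _∷_; lookup; map; zipWith; replicate)
open import Data.Vec.Properties using (map-cong; map-id; map-∘; map-const; lookup-map; lookup-replicate; zipWith-replicate₁; zipWith-map₁; ∷-injective)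
open import Data.Vec.Relation.Binary.Pointwise.Extensional using (ext; Pointwise-≡⇒≡)
open import Data.Product using (∃; ∃₂; _×_; _,_; proj₁; proj₂)
open import Data.Sum using (_⊎_; inj₁; inj₂)
open import Data.Empty using (⊥-elim)
open import Data.List using (List; []; _∷_; length; filter; allFin; cartesianProductWith; _++_) renaming (map to mapᴸ)
open import Data.List.Properties using (length-++; length-map)
open import Data.List.Membership.Propositional using (_∈_)
open import Data.List.Membership.Propositional.Properties using (∈-filter⁺; ∈-filter⁻; ∈-allFin; ∈-cartesianProductWith⁺; ∈-cartesianProductWith⁻)
open import Data.List.Relation.Unary.Any using (here; there)
import Data.List.Relation.Unary.All as All
open import Data.List.Relation.Unary.AllPairs using (_∷_; [])
import Data.List.Relation.Unary.Unique.Propositional.Properties as Unique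
open import Relation.Unary using (Decidable)
open import Relation.Nullary using (¬_)
open import Relation.Binary.PropositionalEquality
open import Function.Bundles using (_⇔_; mk⇔; Equivalence)

open Equivalence using (to; from)
open ≡-Reasoning

cardinality-cong : {A : Set} {P Q : A → Set} {n : ℕ} →
                   (∀ x → Q x ⇔ P x) → HasCardinality P n → HasCardinality Q n
cardinality-cong Q⇔P (xs , unique , xs⇔P , len) =
  xs , unique , (λ x → mk⇔ (λ x∈ → from (Q⇔P x) (to (xs⇔P x) x∈))
                           (λ q → from (xs⇔P x) (to (Q⇔P x) q))) , len

cardinality-empty : {A : Set} {P : A → Set} → (∀ x → ¬ P x) → HasCardinality P 0
cardinality-empty ¬P = [] , [] , (λ x → mk⇔ (λ ()) (λ p → ⊥-elim (¬P x p))) , refl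

cardinality-insert : {A : Set} {P : A → Set} {n : ℕ} (a : A) → ¬ P a →
                     HasCardinality P n → HasCardinality (λ x → x ≡ a ⊎ P x) (suc n)
cardinality-insert {P = P} a ¬Pa (xs , unique , xs⇔P , len) =
  a ∷ xs , All.tabulate a∉xs ∷ unique , (λ x → mk⇔ (to′ x) (from′ x)) , cong suc len
  where
  a∉xs : ∀ {x} → x ∈ xs → a ≢ x
  a∉xs x∈ refl = ¬Pa (to (xs⇔P a) x∈)

  to′ : ∀ x → x ∈ a ∷ xs → x ≡ a ⊎ P x
  to′ x (here x≡a) = inj₁ x≡a
  to′ x (there x∈) = inj₂ (to (xs⇔P x) x∈)

  from′ : ∀ x → x ≡ a ⊎ P x → x ∈ a ∷ xs
  from′ x (inj₁ x≡a) = here x≡a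
  from′ x (inj₂ Px)  = there (from (xs⇔P x) Px)

-- A decidable predicate on Fin n has the cardinality of its filter of allFin n;
-- for closed predicates this number is computed by evaluation.
cardinality-decidable : {n : ℕ} {P : Fin n → Set} (P? : Decidable P) →
                        HasCardinality P (length (filter P? (allFin n)))
cardinality-decidable {n} P? =
  filter P? (allFin n) , Unique.filter⁺ P? (Unique.allFin⁺ n) ,
  (λ x → mk⇔ (λ x∈ → proj₂ (∈-filter⁻ P? {xs = allFin n} x∈)) (∈-filter⁺ P? (∈-allFin x))) , refl

length-cartesianProductWith : {A B C : Set} (f : A → B → C) (xs : List A) (ys : List B) →
                              length (cartesianProductWith f xs ys) ≡ length xs * length ys
length-cartesianProductWith f []       ys = refl
length-cartesianProductWith f (x ∷ xs) ys = begin
  length (mapᴸ (f x) ys ++ cartesianProductWith f xs ys)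
    ≡⟨ length-++ (mapᴸ (f x) ys) ⟩
  length (mapᴸ (f x) ys) + length (cartesianProductWith f xs ys)
    ≡⟨ cong₂ _+_ (length-map (f x) ys) (length-cartesianProductWith f xs ys) ⟩
  length ys + length xs * length ys ∎

cardinality-image₂ : {A B C : Set} {P : A → Set} {Q : B → Set} {m n : ℕ} (f : A → B → C) →
                     (∀ {a a′ b b′} → f a b ≡ f a′ b′ → a ≡ a′ × b ≡ b′) →
                     HasCardinality P m → HasCardinality Q n →
                     HasCardinality (λ c → ∃₂ λ a b → P a × Q b × c ≡ f a b) (m * n)
cardinality-image₂ f f-injective (xs , xs-unique , xs⇔P , refl) (ys , ys-unique , ys⇔Q , refl) =
  cartesianProductWith f xs ys ,
  Unique.cartesianProductWith⁺ f f-injective xs-unique ys-unique ,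
  (λ c → mk⇔ to′ from′) ,
  length-cartesianProductWith f xs ys
  where
  to′ : ∀ {c} → c ∈ cartesianProductWith f xs ys → ∃₂ λ a b → _ × _ × c ≡ f a b
  to′ c∈ with a , b , a∈ , b∈ , c≡fab ← ∈-cartesianProductWith⁻ f xs ys c∈ =
    a , b , to (xs⇔P a) a∈ , to (ys⇔Q b) b∈ , c≡fab

  from′ : ∀ {c} → (∃₂ λ a b → _ × _ × c ≡ f a b) → c ∈ cartesianProductWith f xs ys
  from′ (a , b , Pa , Qb , refl) = ∈-cartesianProductWith⁺ f (from (xs⇔P a) Pa) (from (ys⇔Q b) Qb)

cardinality-× : {A B : Set} {P : A → Set} {Q : B → Set} {m n : ℕ} →
                HasCardinality P m → HasCardinality Q n →
                HasCardinality (λ (x : A × B) → P (proj₁ x) × Q (proj₂ x)) (m * n)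
cardinality-× cardP cardQ =
  cardinality-cong (λ x → mk⇔ (λ (Pa , Qb) → _ , _ , Pa , Qb , refl)
                              (λ { (_ , _ , Pa , Qb , refl) → Pa , Qb }))
                   (cardinality-image₂ _,_ (λ { refl → refl , refl }) cardP cardQ)

cardinality-Π : {A : Set} {c : ℕ} (n : ℕ) {Q : Fin n → A → Set} →
                (∀ i → HasCardinality (Q i) c) →
                HasCardinality (λ (v : Vec A n) → ∀ i → Q i (lookup v i)) (c ^ n)
cardinality-Π zero    cardQ =
  ([] ∷ []) , (All.[] ∷ []) , (λ { [] → mk⇔ (λ _ ()) (λ _ → here refl) }) , refl
cardinality-Π (suc n) {Q} cardQ =
  cardinality-cong (λ { (x ∷ v) → mk⇔ (λ q → x , v , q zero , (λ i → q (suc i)) , refl) coordinates })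
                   (cardinality-image₂ _∷_ ∷-injective (cardQ zero) (cardinality-Π n (λ i → cardQ (suc i))))
  where
  coordinates : ∀ {v} → (∃₂ λ a w → Q zero a × (∀ i → Q (suc i) (lookup w i)) × v ≡ a ∷ w) →
                ∀ i → Q i (lookup v i)
  coordinates (_ , _ , Qa , Qw , refl) zero    = Qa
  coordinates (_ , _ , Qa , Qw , refl) (suc i) = Qw i

_⊙_ : {m : ℕ} → ℕ → Fin (suc m) → Fin (suc m)
zero  ⊙ x = zero
suc k ⊙ x = x +ₘ (k ⊙ x)

%-absorbʳ-+ : ∀ a b d .{{_ : NonZero d}} → (a + b % d) % d ≡ (a + b) % d
%-absorbʳ-+ a b d = begin
  (a + b % d) % d         ≡⟨ %-distribˡ-+ a (b % d) d ⟩
  (a % d + b % d % d) % d ≡⟨ cong (λ t → (a % d + t) % d) (m%n%n≡m%n b d) ⟩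
  (a % d + b % d) % d     ≡⟨ %-distribˡ-+ a b d ⟨
  (a + b) % d             ∎

%-absorbʳ-* : ∀ a b d .{{_ : NonZero d}} → (a * (b % d)) % d ≡ (a * b) % d
%-absorbʳ-* a b d = begin
  (a * (b % d)) % d         ≡⟨ %-distribˡ-* a (b % d) d ⟩
  (a % d * (b % d % d)) % d ≡⟨ cong (λ t → (a % d * t) % d) (m%n%n≡m%n b d) ⟩
  (a % d * (b % d)) % d     ≡⟨ %-distribˡ-* a b d ⟨
  (a * b) % d               ∎

toℕ-+ₘ : {m : ℕ} (x y : Fin (suc m)) → toℕ (x +ₘ y) ≡ (toℕ x + toℕ y) % suc m
toℕ-+ₘ x y = toℕ-fromℕ< _

toℕ-⊙ : {m : ℕ} (k : ℕ) (x : Fin (suc m)) → toℕ (k ⊙ x) ≡ k * toℕ x % suc m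
toℕ-⊙ zero x = refl
toℕ-⊙ {m} (suc k) x = begin
  toℕ (x +ₘ (k ⊙ x))                  ≡⟨ toℕ-+ₘ x (k ⊙ x) ⟩
  (toℕ x + toℕ (k ⊙ x)) % suc m       ≡⟨ cong (λ t → (toℕ x + t) % suc m) (toℕ-⊙ k x) ⟩
  (toℕ x + k * toℕ x % suc m) % suc m ≡⟨ %-absorbʳ-+ (toℕ x) (k * toℕ x) (suc m) ⟩
  (toℕ x + k * toℕ x) % suc m         ∎

toℕ-reduced : {m : ℕ} (x : Fin (suc m)) → toℕ x % suc m ≡ toℕ x
toℕ-reduced x = m<n⇒m%n≡m (toℕ<n x)

+ₘ-identityˡ : {m : ℕ} (y : Fin (suc m)) → zero +ₘ y ≡ y
+ₘ-identityˡ y = toℕ-injective (trans (toℕ-+ₘ zero y) (toℕ-reduced y))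

⊙-identityˡ : {m : ℕ} (x : Fin (suc m)) → 1 ⊙ x ≡ x
⊙-identityˡ {m} x = toℕ-injective (begin
  toℕ (1 ⊙ x)          ≡⟨ toℕ-⊙ 1 x ⟩
  1 * toℕ x % suc m    ≡⟨ cong (_% suc m) (*-identityˡ (toℕ x)) ⟩
  toℕ x % suc m        ≡⟨ toℕ-reduced x ⟩
  toℕ x                ∎)

⊙-distribʳ : {m : ℕ} (a k : ℕ) (x : Fin (suc m)) → (a + k) ⊙ x ≡ (a ⊙ x) +ₘ (k ⊙ x)
⊙-distribʳ {m} a k x = toℕ-injective (begin
  toℕ ((a + k) ⊙ x)                              ≡⟨ toℕ-⊙ (a + k) x ⟩
  (a + k) * toℕ x % suc m                        ≡⟨ cong (_% suc m) (*-distribʳ-+ (toℕ x) a k) ⟩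
  (a * toℕ x + k * toℕ x) % suc m                ≡⟨ %-distribˡ-+ (a * toℕ x) (k * toℕ x) (suc m) ⟩
  (a * toℕ x % suc m + k * toℕ x % suc m) % suc m ≡⟨ cong₂ (λ t u → (t + u) % suc m) (toℕ-⊙ a x) (toℕ-⊙ k x) ⟨
  (toℕ (a ⊙ x) + toℕ (k ⊙ x)) % suc m            ≡⟨ toℕ-+ₘ (a ⊙ x) (k ⊙ x) ⟨
  toℕ ((a ⊙ x) +ₘ (k ⊙ x))                       ∎)

⊙-assoc : {m : ℕ} (k l : ℕ) (x : Fin (suc m)) → k ⊙ (l ⊙ x) ≡ (k * l) ⊙ x
⊙-assoc {m} k l x = toℕ-injective (begin
  toℕ (k ⊙ (l ⊙ x))           ≡⟨ toℕ-⊙ k (l ⊙ x) ⟩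
  k * toℕ (l ⊙ x) % suc m     ≡⟨ cong (λ t → k * t % suc m) (toℕ-⊙ l x) ⟩
  k * (l * toℕ x % suc m) % suc m ≡⟨ %-absorbʳ-* k (l * toℕ x) (suc m) ⟩
  k * (l * toℕ x) % suc m     ≡⟨ cong (_% suc m) (*-assoc k l (toℕ x)) ⟨
  k * l * toℕ x % suc m       ≡⟨ toℕ-⊙ (k * l) x ⟨
  toℕ ((k * l) ⊙ x)           ∎)

⊙-annihilate : {m a : ℕ} → suc m ∣ a → (x : Fin (suc m)) → a ⊙ x ≡ zero
⊙-annihilate {m} {a} m+1∣a x = toℕ-injective (begin
  toℕ (a ⊙ x)                     ≡⟨ toℕ-⊙ a x ⟩
  a * toℕ x % suc m               ≡⟨ %-distribˡ-* a (toℕ x) (suc m) ⟩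
  a % suc m * (toℕ x % suc m) % suc m ≡⟨ cong (λ t → t * (toℕ x % suc m) % suc m) (n∣m⇒m%n≡0 a (suc m) m+1∣a) ⟩
  0                               ∎)

_·ᶜ_ : {r s : ℕ} → ℕ → G r s → G r s
k ·ᶜ (u , v) = map (k ⊙_) u , map (k ⊙_) v

zipWith-diagonal : {A B C : Set} {n : ℕ} (f : A → B → C) (h : A → B) (u : Vec A n) →
                   zipWith f u (map h u) ≡ map (λ x → f x (h x)) u
zipWith-diagonal f h []      = refl
zipWith-diagonal f h (x ∷ u) = cong (f x (h x) ∷_) (zipWith-diagonal f h u)

·-coordinatewise : {r s : ℕ} (k : ℕ) (β : G r s) → k · β ≡ k ·ᶜ β
·-coordinatewise zero    (u , v) = sym (cong₂ _,_ (map-const u zero) (map-const v zero))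
·-coordinatewise (suc k) (u , v) =
  trans (cong ((u , v) ⊕_) (·-coordinatewise k (u , v)))
        (cong₂ _,_ (zipWith-diagonal _+ₘ_ (k ⊙_) u) (zipWith-diagonal _+ₘ_ (k ⊙_) v))

map-≡⇔ : {A B : Set} {n : ℕ} (f : A → B) (u : Vec A n) (w : Vec B n) →
         (map f u ≡ w) ⇔ (∀ i → f (lookup u i) ≡ lookup w i)
map-≡⇔ f u w = mk⇔
  (λ fu≡w i → trans (sym (lookup-map i f u)) (cong (λ t → lookup t i) fu≡w))
  (λ eqs → Pointwise-≡⇒≡ (ext (λ i → trans (lookup-map i f u) (eqs i))))

·-≡⇔ : {r s : ℕ} (k : ℕ) (β γ : G r s) →
       (k · β ≡ γ) ⇔ ((∀ i → k ⊙ lookup (proj₁ β) i ≡ lookup (proj₁ γ) i)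
                      × (∀ j → k ⊙ lookup (proj₂ β) j ≡ lookup (proj₂ γ) j))
·-≡⇔ k β@(u , v) γ@(u′ , v′) = mk⇔
  (λ kβ≡γ → let kβᶜ≡γ = trans (sym (·-coordinatewise k β)) kβ≡γ in
            to (map-≡⇔ (k ⊙_) u u′) (cong proj₁ kβᶜ≡γ) , to (map-≡⇔ (k ⊙_) v v′) (cong proj₂ kβᶜ≡γ))
  (λ (eqs₁ , eqs₂) → trans (·-coordinatewise k β)
                           (cong₂ _,_ (from (map-≡⇔ (k ⊙_) u u′) eqs₁) (from (map-≡⇔ (k ⊙_) v v′) eqs₂)))

·-identityˡ : {r s : ℕ} (β : G r s) → 1 · β ≡ β
·-identityˡ β = from (·-≡⇔ 1 β β) ((λ i → ⊙-identityˡ _) , (λ j → ⊙-identityˡ _))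

⊕-identityˡ : {r s : ℕ} (γ : G r s) → 0G ⊕ γ ≡ γ
⊕-identityˡ (u , v) = cong₂ _,_ (zero-plus u) (zero-plus v)
  where
  zero-plus : ∀ {m n} (w : Vec (Fin (suc m)) n) → zipWith _+ₘ_ (replicate n zero) w ≡ w
  zero-plus w = trans (zipWith-replicate₁ _+ₘ_ zero w) (trans (map-cong +ₘ-identityˡ w) (map-id w))

·-distribʳ : {r s : ℕ} (a k : ℕ) (β : G r s) → (a + k) · β ≡ (a · β) ⊕ (k · β)
·-distribʳ a k β@(u , v) = begin
  (a + k) · β             ≡⟨ ·-coordinatewise (a + k) β ⟩
  (a + k) ·ᶜ β            ≡⟨ cong₂ _,_ (distrib u) (distrib v) ⟩
  (a ·ᶜ β) ⊕ (k ·ᶜ β)     ≡⟨ cong₂ _⊕_ (·-coordinatewise a β) (·-coordinatewise k β) ⟨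
  (a · β) ⊕ (k · β)       ∎
  where
  distrib : ∀ {m n} (w : Vec (Fin (suc m)) n) →
            map ((a + k) ⊙_) w ≡ zipWith _+ₘ_ (map (a ⊙_) w) (map (k ⊙_) w)
  distrib w = trans (map-cong (⊙-distribʳ a k) w)
                    (sym (trans (zipWith-map₁ _+ₘ_ (a ⊙_) w (map (k ⊙_) w))
                                (zipWith-diagonal (λ x y → (a ⊙ x) +ₘ y) (k ⊙_) w)))

·-assoc : {r s : ℕ} (k l : ℕ) (β : G r s) → k · (l · β) ≡ (k * l) · β
·-assoc k l β@(u , v) = begin
  k · (l · β)                                    ≡⟨ cong (k ·_) (·-coordinatewise l β) ⟩
  k · (l ·ᶜ β)                                   ≡⟨ ·-coordinatewise k (l ·ᶜ β) ⟩
  map (k ⊙_) (map (l ⊙_) u) , map (k ⊙_) (map (l ⊙_) v) ≡⟨ cong₂ _,_ (assoc u) (assoc v) ⟩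
  (k * l) ·ᶜ β                                   ≡⟨ ·-coordinatewise (k * l) β ⟨
  (k * l) · β                                    ∎
  where
  assoc : ∀ {m n} (w : Vec (Fin (suc m)) n) → map (k ⊙_) (map (l ⊙_) w) ≡ map ((k * l) ⊙_) w
  assoc w = trans (sym (map-∘ (k ⊙_) (l ⊙_) w)) (map-cong (⊙-assoc k l) w)

-- G has exponent 4, since 2 ∣ 4 and 4 ∣ 4.
·-exponent : {r s : ℕ} (β : G r s) → 4 · β ≡ 0G
·-exponent β@(u , v) = trans (·-coordinatewise 4 β) (cong₂ _,_ (vanish (divides 2 refl) u) (vanish (divides 1 refl) v))
  where
  vanish : ∀ {m n} → suc m ∣ 4 → (w : Vec (Fin (suc m)) n) → map (4 ⊙_) w ≡ replicate n zero
  vanish m+1∣4 w = trans (map-cong (⊙-annihilate m+1∣4) w) (map-const w zero)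

·-absorb : {r s : ℕ} {β : G r s} (a : ℕ) → a · β ≡ 0G → ∀ k → (a + k) · β ≡ k · β
·-absorb {β = β} a aβ≡0 k = begin
  (a + k) · β       ≡⟨ ·-distribʳ a k β ⟩
  (a · β) ⊕ (k · β) ≡⟨ cong (_⊕ (k · β)) aβ≡0 ⟩
  0G ⊕ (k · β)      ≡⟨ ⊕-identityˡ (k · β) ⟩
  k · β             ∎

multiples : {r s : ℕ} (β : G r s) (k : ℕ) →
            k · β ≡ 0G ⊎ k · β ≡ β ⊎ k · β ≡ 2 · β ⊎ k · β ≡ 3 · β
multiples β 0 = inj₁ refl
multiples β 1 = inj₂ (inj₁ (·-identityˡ β))
multiples β 2 = inj₂ (inj₂ (inj₁ refl))
multiples β 3 = inj₂ (inj₂ (inj₂ refl))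
multiples β (suc (suc (suc (suc k)))) rewrite ·-absorb 4 (·-exponent β) k = multiples β k

multiples-of-involution : {r s : ℕ} {α : G r s} → 2 · α ≡ 0G → (k : ℕ) → k · α ≡ 0G ⊎ k · α ≡ α
multiples-of-involution         2α≡0 0 = inj₁ refl
multiples-of-involution {α = α} 2α≡0 1 = inj₂ (·-identityˡ α)
multiples-of-involution         2α≡0 (suc (suc k)) rewrite ·-absorb 2 2α≡0 k = multiples-of-involution 2α≡0 k

-- Multiplication by 3 is an involution, as 9 ≡ 1 modulo the exponent 4.
·-3-involutive : {r s : ℕ} (β : G r s) → 3 · (3 · β) ≡ β
·-3-involutive β = begin
  3 · (3 · β) ≡⟨ ·-assoc 3 3 β ⟩
  9 · β       ≡⟨ ·-absorb 4 (·-exponent β) 5 ⟩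
  5 · β       ≡⟨ ·-absorb 4 (·-exponent β) 1 ⟩
  1 · β       ≡⟨ ·-identityˡ β ⟩
  β           ∎

neighbours-of-involution : {r s : ℕ} {α : G r s} → 2 · α ≡ 0G → α ≢ 0G →
                           ∀ β → Adjacent α β ⇔ (β ≡ 0G ⊎ 2 · β ≡ α)
neighbours-of-involution {α = α} 2α≡0 α≢0 β = mk⇔ neighbour→ →neighbour
  where
  -- If 3 · β ≡ α then β ≡ 3 · α, and 3 · α is 0 or α.
  via-3α : α ≢ β → β ≡ 3 · α → β ≡ 0G
  via-3α α≢β β≡3α with multiples-of-involution 2α≡0 3
  ... | inj₁ 3α≡0 = trans β≡3α 3α≡0
  ... | inj₂ 3α≡α = ⊥-elim (α≢β (sym (trans β≡3α 3α≡α)))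

  neighbour→ : Adjacent α β → β ≡ 0G ⊎ 2 · β ≡ α
  neighbour→ (α≢β , inj₁ (k , kα≡β)) with multiples-of-involution 2α≡0 k
  ... | inj₁ kα≡0 = inj₁ (trans (sym kα≡β) kα≡0)
  ... | inj₂ kα≡α = ⊥-elim (α≢β (trans (sym kα≡α) kα≡β))
  neighbour→ (α≢β , inj₂ (k , kβ≡α)) with multiples β k
  ... | inj₁ kβ≡0                = ⊥-elim (α≢0 (trans (sym kβ≡α) kβ≡0))
  ... | inj₂ (inj₁ kβ≡β)         = ⊥-elim (α≢β (trans (sym kβ≡α) kβ≡β))
  ... | inj₂ (inj₂ (inj₁ kβ≡2β)) = inj₂ (trans (sym kβ≡2β) kβ≡α)
  ... | inj₂ (inj₂ (inj₂ kβ≡3β)) =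
    inj₁ (via-3α α≢β (trans (sym (·-3-involutive β)) (cong (3 ·_) (trans (sym kβ≡3β) kβ≡α))))

  →neighbour : β ≡ 0G ⊎ 2 · β ≡ α → Adjacent α β
  →neighbour (inj₁ refl) = α≢0 , inj₁ (0 , refl)
  →neighbour (inj₂ 2β≡α) = (λ { refl → α≢0 (trans (sym 2β≡α) 2α≡0) }) , inj₂ (2 , 2β≡α)

degree-of-involution : {r s n : ℕ} {α : G r s} → 2 · α ≡ 0G → α ≢ 0G →
                       HasCardinality (λ β → 2 · β ≡ α) n → HasDegree α (suc n)
degree-of-involution {α = α} 2α≡0 α≢0 halves =
  cardinality-cong (neighbours-of-involution 2α≡0 α≢0)
                   (cardinality-insert 0G (λ 2·0≡α → α≢0 (trans (sym 2·0≡α) (·-assoc 2 0 α))) halves)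

-- If some ℤ₂-coordinate of α is nonzero, α has no halves (2 · x = 0 in ℤ₂).
no-halves : {r s : ℕ} {α : G r s} → (∃ λ (i : Fin r) → lookup (proj₁ α) i ≢ zero) →
            ∀ β → 2 · β ≢ α
no-halves {α = α} (i , αᵢ≢0) β 2β≡α =
  αᵢ≢0 (trans (sym (proj₁ (to (·-≡⇔ 2 β α) 2β≡α) i)) (⊙-annihilate (divides 1 refl) (lookup (proj₁ β) i)))

halves-in-ℤ₂ : HasCardinality (λ (y : Fin 2) → 2 ⊙ y ≡ zero) 2
halves-in-ℤ₂ = cardinality-decidable (λ y → 2 ⊙ y ≟ zero)

halves-in-ℤ₄ : (a : Fin 4) → 2 ⊙ a ≡ zero → HasCardinality (λ y → 2 ⊙ y ≡ a) 2
halves-in-ℤ₄ zero                   _  = cardinality-decidable (λ y → 2 ⊙ y ≟ zero)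
halves-in-ℤ₄ (suc (suc zero))       _  = cardinality-decidable (λ y → 2 ⊙ y ≟ suc (suc zero))
halves-in-ℤ₄ (suc zero)             ()
halves-in-ℤ₄ (suc (suc (suc zero))) ()

halves-count : {r s : ℕ} {α : G r s} → 2 · α ≡ 0G → (∀ i → lookup (proj₁ α) i ≡ zero) →
               HasCardinality (λ β → 2 · β ≡ α) (2 ^ (r + s))
halves-count {r} {s} {α} 2α≡0 α₁≡0 =
  subst (HasCardinality _) (sym (^-distribˡ-+-* 2 r s))
    (cardinality-cong (λ β → ·-≡⇔ 2 β α)
      (cardinality-× (cardinality-Π r ℤ₂-coordinate) (cardinality-Π s ℤ₄-coordinate)))
  where
  ℤ₂-coordinate : ∀ i → HasCardinality (λ y → 2 ⊙ y ≡ lookup (proj₁ α) i) 2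
  ℤ₂-coordinate i = subst (λ a → HasCardinality (λ y → 2 ⊙ y ≡ a) 2) (sym (α₁≡0 i)) halves-in-ℤ₂

  ℤ₄-coordinate : ∀ j → HasCardinality (λ y → 2 ⊙ y ≡ lookup (proj₂ α) j) 2
  ℤ₄-coordinate j = halves-in-ℤ₄ (lookup (proj₂ α) j)
    (trans (proj₂ (to (·-≡⇔ 2 α 0G) 2α≡0) j) (lookup-replicate j zero))

theorem3p9 : (r s : ℕ) → 1 ≤ r → 1 ≤ s → (α : G r s) → HasOrder α 2 →
      ((∃ λ (i : Fin r) → lookup (proj₁ α) i ≢ zero) → HasDegree α 1)
    × ((∀ (i : Fin r) → lookup (proj₁ α) i ≡ zero) → HasDegree α (2 ^ (r + s) + 1))
theorem3p9 r s _ _ α (_ , 2α≡0 , minimal) = case-i , case-ii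
  where
  α≢0 : α ≢ 0G
  α≢0 α≡0 = minimal 1 (s≤s z≤n) (s≤s (s≤s z≤n)) (trans (·-identityˡ α) α≡0)

  case-i : (∃ λ (i : Fin r) → lookup (proj₁ α) i ≢ zero) → HasDegree α 1
  case-i nonzero = degree-of-involution 2α≡0 α≢0 (cardinality-empty (no-halves nonzero))

  case-ii : (∀ (i : Fin r) → lookup (proj₁ α) i ≡ zero) → HasDegree α (2 ^ (r + s) + 1)
  case-ii α₁≡0 = subst (HasDegree α) (+-comm 1 (2 ^ (r + s)))
                       (degree-of-involution 2α≡0 α≢0 (halves-count 2α≡0 α₁≡0))
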